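{- Let $l$ be a rational prime. Given any positive integer $s$ and any finite set $S$ of rational primes, there exists a positive integer $N$, not divisible by $l$ nor by any prime in $S$, such that, letting $r$ be the smallest positive integer with $N\mid l^r-1$: (1) $s\mid r$; and (2) if $r$ is even then $N\nmid l^{r/2}+1$. -}

module Defs where

open import Data.Nat using (ℕ; _^_; _∸_; _<_; _≤_)
open import Data.Nat.Divisibility using (_∣_)
open import Data.Product using (_×_)

-- r is the smallest positive integer with N ∣ l^r - 1
-- (l^r ≥ 1 whenever l ≥ 1, so truncated subtraction is the true one here).
IsMultOrder : ℕ → ℕ → ℕ → Set
IsMultOrder l N r =
  (0 < r) × (N ∣ (l ^ r ∸ 1)) × (∀ r′ → 0 < r′ → N ∣ (l ^ r′ ∸ 1) → r ≤ r′)

{-# OPTIONS --safe #-}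
module Submission where

-- Write Φₚ(y) = 1 + y + ⋯ + y^(p−1) = geom y p. For a prime p and y ≡ 1 (mod p²) one has
-- Φₚ(y) ≡ p (mod p²), so Φₚ(y) = p B with B ≡ 1 (mod p); if instead p ∣ y, take B = Φₚ(y).
-- Such a B > 1 is prime to y and to y − 1, and y has order exactly p modulo B. Let K be the
-- product of the primes of S other than l. If y = l^T ≡ 1 (mod N K), adjoining B to a modulus N
-- all of whose l-periods are multiples of s makes them multiples of p s; iterating over the
-- prime factors of 2 s yields such an N₁ for 2 s. Finally take y = l^T ≡ 1 (mod N₁ K) and
-- B ∣ y + 1 with B odd. If r is the order of l modulo N₁ B and l^(r/2) ≡ −1, then r/2 divides T,
-- and depending on the parity of 2T/r either B or N₁ divides 2, which is impossible as B is odd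
-- and the l-periods of N₁ are even.

open import Data.Fin using (toℕ; fromℕ<)
open import Data.Fin.Properties using (pigeonhole; toℕ-fromℕ<)
open import Data.List using (List; []; _∷_; filter)
open import Data.List.Membership.Propositional using (_∈_)
open import Data.List.Membership.Propositional.Properties using (∈-filter⁺)
open import Data.List.Relation.Unary.All using (All; []; _∷_; lookup)
open import Data.List.Relation.Unary.All.Properties using (all-filter; filter⁺)
open import Data.Nat.Base
open import Data.Nat.Coprimality
  using (Coprime; coprime-Bézout; coprime-divisor; 1-coprimeTo; 0-coprimeTo-m⇒m≡1)
  renaming (sym to coprime-sym)
open import Data.Nat.DivMod
open import Data.Nat.Divisibility
open import Data.Nat.GCD using (module Bézout)
open import Data.Nat.ListAction using (product)
open import Data.Nat.ListAction.Properties using (∈⇒∣product)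
open import Data.Nat.Primality
open import Data.Nat.Primality.Factorisation using (factorise; PrimeFactorisation)
open import Data.Nat.Properties
open import Data.Nat.Tactic.RingSolver using (solve-∀)
open import Data.Product using (_×_; _,_; proj₂; ∃-syntax)
open import Data.Sum using (_⊎_; inj₁; inj₂; [_,_])
open import Function using (case_of_; _∘_)
open import Relation.Binary.PropositionalEquality
  using (_≡_; _≢_; refl; sym; trans; cong; cong₂; subst; subst₂; module ≡-Reasoning)
open import Relation.Nullary using (¬_; yes; no; ¬?; contradiction)
open import Relation.Nullary.Decidable using (_×-dec_)
open import Relation.Unary using (Decidable)

open import Defs

module _ (n : ℕ) .{{_ : NonZero n}} where

  %-cong-+ : ∀ {a b c d} → a % n ≡ b % n → c % n ≡ d % n → (a + c) % n ≡ (b + d) % n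
  %-cong-+ {a} {b} {c} {d} a≡b c≡d = begin
    (a + c) % n           ≡⟨ %-distribˡ-+ a c n ⟩
    (a % n + c % n) % n   ≡⟨ cong₂ (λ x y → (x + y) % n) a≡b c≡d ⟩
    (b % n + d % n) % n   ≡⟨ %-distribˡ-+ b d n ⟨
    (b + d) % n           ∎
    where open ≡-Reasoning

  %-cong-* : ∀ {a b c d} → a % n ≡ b % n → c % n ≡ d % n → a * c % n ≡ b * d % n
  %-cong-* {a} {b} {c} {d} a≡b c≡d = begin
    a * c % n             ≡⟨ %-distribˡ-* a c n ⟩
    (a % n * (c % n)) % n ≡⟨ cong₂ (λ x y → (x * y) % n) a≡b c≡d ⟩
    (b % n * (d % n)) % n ≡⟨ %-distribˡ-* b d n ⟨
    b * d % n             ∎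
    where open ≡-Reasoning

  ∣∸⇒%≡ : ∀ {a b} → b ≤ a → n ∣ a ∸ b → a % n ≡ b % n
  ∣∸⇒%≡ {a} {b} b≤a n∣a∸b = begin
    a % n             ≡⟨ cong (_% n) (m∸n+n≡m b≤a) ⟨
    (a ∸ b + b) % n   ≡⟨ %-remove-+ˡ b n∣a∸b ⟩
    b % n             ∎
    where open ≡-Reasoning

  %≡⇒∣∸ : ∀ {a b} → a % n ≡ b % n → n ∣ a ∸ b
  %≡⇒∣∸ {a} {b} a≡b = divides (a / n ∸ b / n) (begin
    a ∸ b                                      ≡⟨ cong₂ _∸_ (m≡m%n+[m/n]*n a n) (m≡m%n+[m/n]*n b n) ⟩
    (a % n + a / n * n) ∸ (b % n + b / n * n)  ≡⟨ cong (λ x → x + a / n * n ∸ b′) a≡b ⟩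
    (b % n + a / n * n) ∸ (b % n + b / n * n)  ≡⟨ [m+n]∸[m+o]≡n∸o (b % n) _ _ ⟩
    a / n * n ∸ b / n * n                      ≡⟨ *-distribʳ-∸ n (a / n) (b / n) ⟨
    (a / n ∸ b / n) * n                        ∎)
    where
    open ≡-Reasoning
    b′ = b % n + b / n * n

2∤1 : ¬ 2 ∣ 1
2∤1 2∣1 with () ← ∣1⇒≡1 2∣1

∣∸1∧∣+1⇒∣2 : ∀ {d m} → 1 ≤ m → d ∣ m ∸ 1 → d ∣ m + 1 → d ∣ 2
∣∸1∧∣+1⇒∣2 {d} {suc m} _ d∣m d∣m+2 =
  ∣m+n∣m⇒∣n (subst (d ∣_) (sym (+-suc m 1)) d∣m+2) d∣m

∤⇒nonZero : ∀ {d n} → ¬ d ∣ n → NonZero n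
∤⇒nonZero {d} d∤n = ≢-nonZero λ { refl → d∤n (d ∣0) }

prime⇒>1 : ∀ {p} → Prime p → 1 < p
prime⇒>1 {p} pp = nonTrivial⇒n>1 p {{prime⇒nonTrivial pp}}

prime⇒≢1 : ∀ {p} → Prime p → p ≢ 1
prime⇒≢1 pp = nonTrivial⇒≢1 {{prime⇒nonTrivial pp}}

m∣m^n : ∀ {a n} → 0 < n → a ∣ a ^ n
m∣m^n {a} {suc n} _ = m∣m*n (a ^ n)

even⊎odd : ∀ n → ∃[ k ] (n ≡ k * 2 ⊎ n ≡ 1 + k * 2)
even⊎odd zero = 0 , inj₁ refl
even⊎odd (suc zero) = 0 , inj₂ refl
even⊎odd (suc (suc n)) with even⊎odd n
... | k , inj₁ refl = suc k , inj₁ refl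
... | k , inj₂ refl = suc k , inj₂ refl

odd⇒2∣∸1 : ∀ n → ¬ 2 ∣ n → 2 ∣ n ∸ 1
odd⇒2∣∸1 n 2∤n with even⊎odd n
... | k , inj₁ refl = contradiction (divides k refl) 2∤n
... | k , inj₂ refl = divides k refl

odd>1⇒∤2 : ∀ {B} → 1 < B → 2 ∣ B ∸ 1 → ¬ B ∣ 2
odd>1⇒∤2 1<B 2∣B∸1 B∣2 with prime⇒irreducible prime[2] B∣2
... | inj₁ refl = <-irrefl refl 1<B
... | inj₂ refl = 2∤1 2∣B∸1

coprime-*ˡ : ∀ {a b c} → Coprime a c → Coprime b c → Coprime (a * b) c
coprime-*ˡ {a} a⊥c b⊥c {d} (d∣ab , d∣c) = b⊥c (coprime-divisor d⊥a d∣ab , d∣c)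
  where
  d⊥a : Coprime d a
  d⊥a (e∣d , e∣a) = a⊥c (e∣a , ∣-trans e∣d d∣c)

coprime-^ˡ : ∀ {a c} k → Coprime a c → Coprime (a ^ k) c
coprime-^ˡ zero    _   = 1-coprimeTo _
coprime-^ˡ (suc k) a⊥c = coprime-*ˡ a⊥c (coprime-^ˡ k a⊥c)

coprime-∣ʳ : ∀ {a b c} → Coprime a b → c ∣ b → Coprime a c
coprime-∣ʳ a⊥b c∣b (d∣a , d∣c) = a⊥b (d∣a , ∣-trans d∣c c∣b)

coprime⇒*∣ : ∀ {a b x} → Coprime a b → a ∣ x → b ∣ x → a * b ∣ x
coprime⇒*∣ {a} {b} a⊥b (divides q refl) b∣qa = divides (quotient b∣q) (begin
    q * a                   ≡⟨ cong (_* a) (m∣n⇒n≡quotient*m b∣q) ⟩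
    quotient b∣q * b * a    ≡⟨ *-assoc (quotient b∣q) b a ⟩
    quotient b∣q * (b * a)  ≡⟨ cong (quotient b∣q *_) (*-comm b a) ⟩
    quotient b∣q * (a * b)  ∎)
  where
  open ≡-Reasoning
  b∣q : b ∣ q
  b∣q = coprime-divisor (coprime-sym a⊥b) (subst (b ∣_) (*-comm q a) b∣qa)

prime∤⇒coprime : ∀ {p n} → Prime p → ¬ p ∣ n → Coprime p n
prime∤⇒coprime pp p∤n (d∣p , d∣n) with prime⇒irreducible pp d∣p
... | inj₁ d≡1 = d≡1
... | inj₂ refl = contradiction d∣n p∤n

prime≢⇒coprime : ∀ {p q} → Prime p → Prime q → p ≢ q → Coprime p q
prime≢⇒coprime pp pq p≢q = prime∤⇒coprime pp λ p∣q →
  [ prime⇒≢1 pp , p≢q ] (prime⇒irreducible pq p∣q)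

product-coprime : ∀ {l qs} → Prime l → All Prime qs → All (_≢ l) qs → Coprime (product qs) l
product-coprime pl []         []           = 1-coprimeTo _
product-coprime pl (pq ∷ pqs) (q≢l ∷ qs≢l) =
  coprime-*ˡ (prime≢⇒coprime pq pl q≢l) (product-coprime pl pqs qs≢l)

geom : ℕ → ℕ → ℕ
geom y zero    = 0
geom y (suc k) = 1 + y * geom y k

geom-2 : ∀ y → geom y 2 ≡ y + 1
geom-2 y = begin
  1 + y * (1 + y * 0) ≡⟨ cong (λ x → 1 + y * (1 + x)) (*-zeroʳ y) ⟩
  1 + y * 1           ≡⟨ cong (1 +_) (*-identityʳ y) ⟩
  1 + y               ≡⟨ +-comm 1 y ⟩
  y + 1               ∎
  where open ≡-Reasoning

geom*pred+1≡^ : ∀ z k → geom (suc z) k * z + 1 ≡ suc z ^ k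
geom*pred+1≡^ z zero    = refl
geom*pred+1≡^ z (suc k) = begin
  (1 + (1 + z) * g) * z + 1 ≡⟨ expand g z ⟩
  (1 + z) * (g * z + 1)     ≡⟨ cong ((1 + z) *_) (geom*pred+1≡^ z k) ⟩
  (1 + z) * (1 + z) ^ k     ∎
  where
  open ≡-Reasoning
  g = geom (suc z) k
  expand : ∀ g z → (1 + (1 + z) * g) * z + 1 ≡ (1 + z) * (g * z + 1)
  expand = solve-∀

^∸1≡geom*pred : ∀ {y} → 1 ≤ y → ∀ k → y ^ k ∸ 1 ≡ geom y k * (y ∸ 1)
^∸1≡geom*pred {suc z} _ k = begin
  suc z ^ k ∸ 1                 ≡⟨ cong (_∸ 1) (geom*pred+1≡^ z k) ⟨
  geom (suc z) k * z + 1 ∸ 1    ≡⟨ m+n∸n≡m _ 1 ⟩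
  geom (suc z) k * z            ∎
  where open ≡-Reasoning

∣geom⇒∣^∸1 : ∀ {d y} k → 1 ≤ y → d ∣ geom y k → d ∣ y ^ k ∸ 1
∣geom⇒∣^∸1 {d} {y} k 1≤y d∣geom =
  subst (d ∣_) (sym (^∸1≡geom*pred 1≤y k)) (∣m⇒∣m*n (y ∸ 1) d∣geom)

n≤geom : ∀ {y} → 1 ≤ y → ∀ k → k ≤ geom y k
n≤geom 1≤y zero    = z≤n
n≤geom {y} 1≤y (suc k) = s≤s (≤-trans (n≤geom 1≤y k) (m≤n*m (geom y k) y {{>-nonZero 1≤y}}))

n<geom : ∀ {y k} → 2 ≤ y → 2 ≤ k → k < geom y k
n<geom {y} {suc k} 2≤y 2≤k = s≤s (begin-strict
  k             ≤⟨ n≤geom 1≤y k ⟩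
  geom y k      <⟨ m<m*n (geom y k) y {{>-nonZero (≤-trans 1≤k (n≤geom 1≤y k))}} 2≤y ⟩
  geom y k * y  ≡⟨ *-comm (geom y k) y ⟩
  y * geom y k  ∎)
  where
  open ≤-Reasoning
  1≤y = ≤-trans (s≤s z≤n) 2≤y
  1≤k = s≤s⁻¹ 2≤k

geom-≡1 : ∀ {y} m .{{_ : NonZero m}} k → y % m ≡ 1 % m → geom y k % m ≡ k % m
geom-≡1 m zero    _   = refl
geom-≡1 {y} m (suc k) y≡1 = begin
  (1 + y * geom y k) % m ≡⟨ %-cong-+ m refl (%-cong-* m y≡1 (geom-≡1 m k y≡1)) ⟩
  (1 + 1 * k) % m        ≡⟨ cong (λ x → suc x % m) (*-identityˡ k) ⟩
  suc k % m              ∎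
  where open ≡-Reasoning

coprime-geom : ∀ {y k} → 0 < k → Coprime (geom y k) y
coprime-geom {y} {suc k} _ {d} (d∣geom , d∣y) =
  ∣1⇒≡1 (∣m+n∣m⇒∣n (subst (d ∣_) (+-comm 1 (y * geom y k)) d∣geom)
                    (∣m⇒∣m*n (geom y k) d∣y))

module _ {P : ℕ → Set} (P? : Decidable P) where

  private
    none-below⊎least : ∀ n → (∀ {k} → k < n → ¬ P k) ⊎
                             ∃[ m ] (P m × ∀ {k} → k < m → ¬ P k)
    none-below⊎least zero = inj₁ λ ()
    none-below⊎least (suc n) with none-below⊎least n
    ... | inj₂ found = inj₂ found
    ... | inj₁ none with P? n
    ...   | yes pn = inj₂ (n , pn , none)
    ...   | no ¬pn = inj₁ λ k<1+n → case m<1+n⇒m<n∨m≡n k<1+n of λ where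
              (inj₁ k<n)  → none k<n
              (inj₂ refl) → ¬pn

  least : ∀ {n} → P n → ∃[ m ] (P m × ∀ {k} → P k → m ≤ k)
  least {n} pn with none-below⊎least (suc n)
  ... | inj₁ none             = contradiction pn (none (n<1+n n))
  ... | inj₂ (m , pm , below) = m , pm , λ pk → ≮⇒≥ (λ k<m → below k<m pk)

order-exists : ∀ {a N E} → 0 < E → N ∣ a ^ E ∸ 1 → ∃[ r ] IsMultOrder a N r
order-exists {a} {N} E>0 N∣E with least (λ r → 0 <? r ×-dec N ∣? a ^ r ∸ 1) (E>0 , N∣E)
... | r , (r>0 , N∣r) , minimal = r , r>0 , N∣r , λ _ r′>0 N∣r′ → minimal (r′>0 , N∣r′)

module _ {a : ℕ} .{{_ : NonZero a}} where

  ∣^∸1⇒∣^*∸1 : ∀ {N} d k → N ∣ a ^ d ∸ 1 → N ∣ a ^ (d * k) ∸ 1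
  ∣^∸1⇒∣^*∸1 {N} d k N∣d = subst (λ e → N ∣ e ∸ 1) (^-*-assoc a d k)
    (∣-trans N∣d (divides (geom (a ^ d) k) (^∸1≡geom*pred (m^n>0 a d) k)))

  ∣^+*∸1⇒∣^∸1 : ∀ {N} .{{_ : NonZero N}} h k r →
                N ∣ a ^ r ∸ 1 → N ∣ a ^ (h + k * r) ∸ 1 → N ∣ a ^ h ∸ 1
  ∣^+*∸1⇒∣^∸1 {N} h k r N∣r N∣h+kr = %≡⇒∣∸ N (begin
    a ^ h % N                 ≡⟨ cong (_% N) (*-identityʳ (a ^ h)) ⟨
    a ^ h * 1 % N             ≡⟨ %-cong-* N {a ^ h} refl (%≡1 (k * r) N∣kr) ⟨
    a ^ h * a ^ (k * r) % N   ≡⟨ cong (_% N) (^-distribˡ-+-* a h (k * r)) ⟨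
    a ^ (h + k * r) % N       ≡⟨ %≡1 (h + k * r) N∣h+kr ⟩
    1 % N                     ∎)
    where
    open ≡-Reasoning
    %≡1 : ∀ d → N ∣ a ^ d ∸ 1 → a ^ d % N ≡ 1 % N
    %≡1 d = ∣∸⇒%≡ N (m^n>0 a d)
    N∣kr : N ∣ a ^ (k * r) ∸ 1
    N∣kr = subst (λ e → N ∣ a ^ e ∸ 1) (*-comm r k) (∣^∸1⇒∣^*∸1 r k N∣r)

  coprime-periods⇒∣∸1 : ∀ {N m n} .{{_ : NonZero N}} → Coprime m n →
                        N ∣ a ^ m ∸ 1 → N ∣ a ^ n ∸ 1 → N ∣ a ∸ 1
  coprime-periods⇒∣∸1 {N} m⊥n = from-identity (coprime-Bézout m⊥n)
    where
    from-identity : ∀ {m n} → Bézout.Identity 1 m n →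
                    N ∣ a ^ m ∸ 1 → N ∣ a ^ n ∸ 1 → N ∣ a ∸ 1
    from-identity {m} {n} (Bézout.-+ x y 1+xm≡yn) N∣m N∣n =
      subst (λ e → N ∣ e ∸ 1) (^-identityʳ a) (∣^+*∸1⇒∣^∸1 1 x m N∣m
        (subst (λ e → N ∣ a ^ e ∸ 1) (trans (*-comm n y) (sym 1+xm≡yn))
               (∣^∸1⇒∣^*∸1 n y N∣n)))
    from-identity (Bézout.+- x y 1+yn≡xm) N∣m N∣n = from-identity (Bézout.-+ y x 1+yn≡xm) N∣n N∣m

  period-exists : ∀ {Q} .{{_ : NonZero Q}} → Coprime Q a → ∃[ M ] (0 < M × Q ∣ a ^ M ∸ 1)
  period-exists {Q} Q⊥a with pigeonhole (n<1+n Q) (λ i → fromℕ< (m%n<n (a ^ toℕ i) Q))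
  ... | i , j , i<j , same =
    toℕ j ∸ toℕ i , m<n⇒0<n∸m i<j , coprime-divisor Q⊥a^i (subst (Q ∣_) factor Q∣)
    where
    open ≡-Reasoning
    Q⊥a^i : Coprime Q (a ^ toℕ i)
    Q⊥a^i = coprime-sym (coprime-^ˡ (toℕ i) (coprime-sym Q⊥a))
    Q∣ : Q ∣ a ^ toℕ j ∸ a ^ toℕ i
    Q∣ = %≡⇒∣∸ Q (trans (sym (toℕ-fromℕ< _)) (trans (cong toℕ (sym same)) (toℕ-fromℕ< _)))
    factor : a ^ toℕ j ∸ a ^ toℕ i ≡ a ^ toℕ i * (a ^ (toℕ j ∸ toℕ i) ∸ 1)
    factor = begin
      a ^ toℕ j ∸ a ^ i′          ≡⟨ cong (λ e → a ^ e ∸ a ^ i′) (m+[n∸m]≡n (<⇒≤ i<j)) ⟨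
      a ^ (i′ + M) ∸ a ^ i′       ≡⟨ cong (_∸ a ^ i′) (^-distribˡ-+-* a i′ M) ⟩
      a ^ i′ * a ^ M ∸ a ^ i′     ≡⟨ cong (a ^ i′ * a ^ M ∸_) (*-identityʳ (a ^ i′)) ⟨
      a ^ i′ * a ^ M ∸ a ^ i′ * 1 ≡⟨ *-distribˡ-∸ (a ^ i′) (a ^ M) 1 ⟨
      a ^ i′ * (a ^ M ∸ 1)        ∎
      where
      i′ = toℕ i
      M  = toℕ j ∸ toℕ i

  order∣period : ∀ {N r x} .{{_ : NonZero N}} → IsMultOrder a N r → N ∣ a ^ x ∸ 1 → r ∣ x
  order∣period {N} {r} {x} (r>0 , N∣r , minimal) N∣x =
    m%n≡0⇒n∣m x r (n≤0⇒n≡0 (≮⇒≥ remainder≯0))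
    where
    instance _ = >-nonZero r>0
    remainder≯0 : ¬ 0 < x % r
    remainder≯0 rem>0 = <⇒≱ (m%n<n x r) (minimal (x % r) rem>0
      (∣^+*∸1⇒∣^∸1 (x % r) (x / r) r N∣r
        (subst (λ e → N ∣ a ^ e ∸ 1) (m≡m%n+[m/n]*n x r) N∣x)))

evenPeriods⇒∤2 : ∀ {l N} → Prime l → ¬ l ∣ N → (∀ {d} → N ∣ l ^ d ∸ 1 → 2 ∣ d) →
                 ¬ N ∣ 2
evenPeriods⇒∤2 {l} {N} pl l∤N 2∣period N∣2 =
  2∤1 (2∣period (subst (λ e → N ∣ e ∸ 1) (sym (^-identityʳ l)) N∣l∸1))
  where
  N∣l∸1 : N ∣ l ∸ 1
  N∣l∸1 with prime⇒irreducible prime[2] N∣2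
  ... | inj₁ refl = 1∣ _
  ... | inj₂ refl = odd⇒2∣∸1 l λ 2∣l → case prime⇒irreducible pl 2∣l of λ where
          (inj₁ ())
          (inj₂ refl) → l∤N ∣-refl

¬∣half-period+1 : ∀ {a N B T h} .{{_ : NonZero a}} .{{_ : NonZero N}} → ¬ N ∣ 2 → ¬ B ∣ 2 →
  N ∣ a ^ T ∸ 1 → B ∣ a ^ T + 1 → N * B ∣ a ^ (h * 2) ∸ 1 → h ∣ T → ¬ N * B ∣ a ^ h + 1
¬∣half-period+1 {a} {N} {B} {h = h} N∤2 B∤2 N∣T B∣T+1 NB∣2h (divides c refl) NB∣h+1
  with even⊎odd c
... | k , inj₁ refl = B∤2 (∣∸1∧∣+1⇒∣2 (m^n>0 a (k * 2 * h)) B∣T∸1 B∣T+1)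
  where
  B∣T∸1 : B ∣ a ^ (k * 2 * h) ∸ 1
  B∣T∸1 = ∣-trans (n∣m*n N)
    (subst (λ e → N * B ∣ a ^ e ∸ 1) (rearrange h k) (∣^∸1⇒∣^*∸1 (h * 2) k NB∣2h))
    where
    rearrange : ∀ h k → h * 2 * k ≡ k * 2 * h
    rearrange = solve-∀
... | k , inj₂ refl = N∤2 (∣∸1∧∣+1⇒∣2 (m^n>0 a h) N∣h∸1 (∣-trans (m∣m*n B) NB∣h+1))
  where
  N∣h∸1 : N ∣ a ^ h ∸ 1
  N∣h∸1 = ∣^+*∸1⇒∣^∸1 h k (h * 2) (∣-trans (m∣m*n B) NB∣2h)
    (subst (λ e → N ∣ a ^ e ∸ 1) (rearrange h k) N∣T)
    where
    rearrange : ∀ h k → (1 + k * 2) * h ≡ h + k * (h * 2)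
    rearrange = solve-∀

record GeomDivisor (y p : ℕ) : Set where
  field
    B      : ℕ
    1<B    : 1 < B
    B∣geom : B ∣ geom y p
    p∣B∸1  : p ∣ B ∸ 1

geomDivisor : ∀ {y p} → Prime p → 2 ≤ y → p ∣ y ⊎ p * p ∣ y ∸ 1 → GeomDivisor y p
geomDivisor {y} {p@(suc p′)} pp 2≤y (inj₁ p∣y) = record
  { B = geom y p ; 1<B = <-trans (prime⇒>1 pp) (n<geom 2≤y (prime⇒>1 pp)) ; B∣geom = ∣-refl
  ; p∣B∸1 = ∣m⇒∣m*n (geom y p′) p∣y }
geomDivisor {y} {p} pp 2≤y (inj₂ p²∣y∸1) = record
  { B = 1 + c * p ; 1<B = 1<B ; B∣geom = divides p geom≡p*B ; p∣B∸1 = divides c refl }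
  where
  instance
    _ = prime⇒nonZero pp
    _ = m*n≢0 p p
  p²∣geom∸p : p * p ∣ geom y p ∸ p
  p²∣geom∸p = %≡⇒∣∸ (p * p)
    (geom-≡1 (p * p) p (∣∸⇒%≡ (p * p) (≤-trans (s≤s z≤n) 2≤y) p²∣y∸1))
  c = quotient p²∣geom∸p
  p<geom : p < geom y p
  p<geom = n<geom 2≤y (prime⇒>1 pp)
  geom≡p*B : geom y p ≡ p * (1 + c * p)
  geom≡p*B = begin
    geom y p          ≡⟨ m∸n+n≡m (<⇒≤ p<geom) ⟨
    geom y p ∸ p + p  ≡⟨ cong (_+ p) (m∣n⇒n≡quotient*m p²∣geom∸p) ⟩
    c * (p * p) + p   ≡⟨ rearrange c p ⟩
    p * (1 + c * p)   ∎
    where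
    open ≡-Reasoning
    rearrange : ∀ c p → c * (p * p) + p ≡ p * (1 + c * p)
    rearrange = solve-∀
  1<B : 1 < 1 + c * p
  1<B = *-cancelˡ-< p 1 (1 + c * p) (subst₂ _<_ (sym (*-identityʳ p)) geom≡p*B p<geom)

module GeomDivisorProperties {y p} .{{_ : NonZero y}} (D : GeomDivisor y p) where
  open GeomDivisor D

  private instance
    _ = >-nonZero (<-trans z<s 1<B)

  B⊥y∸1 : Coprime B (y ∸ 1)
  B⊥y∸1 {d} (d∣B , d∣y∸1) =
    ∣1⇒≡1 (∣m+n∣m⇒∣n (subst (d ∣_) (sym (m∸n+n≡m (<⇒≤ 1<B))) d∣B) d∣B∸1)
    where
    instance _ = ≢-nonZero λ { refl → <⇒≢ (<-trans z<s 1<B) (sym (0∣⇒≡0 d∣B)) }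
    d∣p : d ∣ p
    d∣p = %≡⇒∣∸ d (trans (sym (geom-≡1 d p (∣∸⇒%≡ d (>-nonZero⁻¹ y) d∣y∸1)))
                         (∣∸⇒%≡ d z≤n (∣-trans d∣B B∣geom)))
    d∣B∸1 : d ∣ B ∸ 1
    d∣B∸1 = ∣-trans d∣p p∣B∸1

  B⊥y : 0 < p → Coprime B y
  B⊥y p>0 = coprime-sym (coprime-∣ʳ (coprime-sym (coprime-geom p>0)) B∣geom)

  p∣period : Prime p → ∀ {k} → B ∣ y ^ k ∸ 1 → p ∣ k
  p∣period pp {k} B∣k with p ∣? k
  ... | yes p∣k = p∣k
  ... | no  p∤k = contradiction (B⊥y∸1 (∣-refl , B∣y∸1)) (<⇒≢ 1<B ∘ sym)
    where
    B∣y∸1 : B ∣ y ∸ 1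
    B∣y∸1 = coprime-periods⇒∣∸1 (prime∤⇒coprime pp p∤k)
              (∣geom⇒∣^∸1 p (>-nonZero⁻¹ y) B∣geom) B∣k

record CyclotomicDivisor (l p t K : ℕ) : Set where
  field
    T       : ℕ
    T>0     : 0 < T
    t∣T     : t ∣ T
    K∣      : K ∣ l ^ T ∸ 1
    divisor : GeomDivisor (l ^ T) p
  open GeomDivisor divisor public

cyclotomicDivisor-via : ∀ {l p t K Q} → Prime l → Prime p → 0 < t → Coprime Q l → K ∣ Q →
  (∀ {T} → 0 < T → Q ∣ l ^ T ∸ 1 → p ∣ l ^ T ⊎ p * p ∣ l ^ T ∸ 1) → CyclotomicDivisor l p t K
cyclotomicDivisor-via {l} {p} {t} {K} {Q} pl pp t>0 Q⊥l K∣Q p∣y⊎p²∣y∸1 =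
  from-period (period-exists Q⊥l)
  where
  instance
    _ = prime⇒nonZero pl
    _ = ≢-nonZero λ { refl → prime⇒≢1 pl (0-coprimeTo-m⇒m≡1 Q⊥l) }
  from-period : ∃[ M ] (0 < M × Q ∣ l ^ M ∸ 1) → CyclotomicDivisor l p t K
  from-period (M , M>0 , Q∣M) = record
    { T = M * t ; T>0 = T>0 ; t∣T = n∣m*n M ; K∣ = ∣-trans K∣Q Q∣T
    ; divisor = geomDivisor pp 2≤l^T (p∣y⊎p²∣y∸1 T>0 Q∣T) }
    where
    T>0 : 0 < M * t
    T>0 = *-mono-< M>0 t>0
    Q∣T : Q ∣ l ^ (M * t) ∸ 1
    Q∣T = ∣^∸1⇒∣^*∸1 M t Q∣M
    2≤l^T : 2 ≤ l ^ (M * t)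
    2≤l^T = ≤-trans (prime⇒>1 pl) (∣⇒≤ {{m^n≢0 l (M * t)}} (m∣m^n T>0))

cyclotomicDivisor : ∀ {l p t K} → Prime l → Prime p → 0 < t → Coprime K l →
                    CyclotomicDivisor l p t K
-- p² is prime to l unless p = l, and then p divides every positive power of l.
cyclotomicDivisor {l} {p} {K = K} pl pp t>0 K⊥l with p ≟ l
... | yes refl = cyclotomicDivisor-via pl pp t>0 K⊥l ∣-refl (λ T>0 _ → inj₁ (m∣m^n T>0))
... | no  p≢l  = cyclotomicDivisor-via pl pp t>0 (coprime-*ˡ K⊥l (coprime-*ˡ p⊥l p⊥l))
                   (m∣m*n (p * p)) (λ _ Q∣ → inj₂ (∣-trans (n∣m*n K) Q∣))
  where p⊥l = prime≢⇒coprime pp pl p≢l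

module CyclotomicDivisorProperties {l p t K} (pl : Prime l) (pp : Prime p) (D : CyclotomicDivisor l p t K) where
  open CyclotomicDivisor D

  private instance
    _ = prime⇒nonZero pl
    _ = m^n≢0 l T

  open GeomDivisorProperties divisor

  B⊥K : Coprime B K
  B⊥K = coprime-∣ʳ B⊥y∸1 K∣

  l∤B : ¬ l ∣ B
  l∤B l∣B = prime⇒≢1 pl (B⊥y (<-trans z<s (prime⇒>1 pp)) (l∣B , m∣m^n T>0))

  p*t∣period : ∀ {d} → B ∣ l ^ d ∸ 1 → t ∣ d → p * t ∣ d
  p*t∣period {d} B∣d (divides k refl) = *-monoˡ-∣ t (p∣period pp {k}
    (subst (λ e → B ∣ e ∸ 1) l^ktj≡y^k (∣^∸1⇒∣^*∸1 (k * t) j B∣d)))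
    where
    j = quotient t∣T
    l^ktj≡y^k : l ^ (k * t * j) ≡ (l ^ T) ^ k
    l^ktj≡y^k = begin
      l ^ (k * t * j)  ≡⟨ cong (l ^_) (rearrange k t j) ⟩
      l ^ (j * t * k)  ≡⟨ cong (λ e → l ^ (e * k)) (m∣n⇒n≡quotient*m t∣T) ⟨
      l ^ (T * k)      ≡⟨ ^-*-assoc l T k ⟨
      (l ^ T) ^ k      ∎
      where
      open ≡-Reasoning
      rearrange : ∀ k t j → k * t * j ≡ j * t * k
      rearrange = solve-∀

record Modulus (l K s N : ℕ) : Set where
  field
    N⊥K      : Coprime N K
    l∤N      : ¬ l ∣ N
    s∣period : ∀ {d} → N ∣ l ^ d ∸ 1 → s ∣ d

modulus-1 : ∀ {l K} → Prime l → Modulus l K 1 1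
modulus-1 pl = record
  { N⊥K = 1-coprimeTo _ ; l∤N = prime⇒≢1 pl ∘ ∣1⇒≡1 ; s∣period = λ {d} _ → 1∣ d }

modulus-coprime : ∀ {l K s N} → Prime l → Coprime K l → Modulus l K s N → Coprime (N * K) l
modulus-coprime pl K⊥l M = coprime-*ˡ (coprime-sym (prime∤⇒coprime pl (Modulus.l∤N M))) K⊥l

modulus-∣ : ∀ {l K s s′ N} → s′ ∣ s → Modulus l K s N → Modulus l K s′ N
modulus-∣ s′∣s M = record { Modulus M ; s∣period = ∣-trans s′∣s ∘ Modulus.s∣period M }

modulus-* : ∀ {l K s N p} → Prime l → Prime p → Modulus l K s N →
            (D : CyclotomicDivisor l p s (N * K)) → Modulus l K (p * s) (N * CyclotomicDivisor.B D)
modulus-* {N = N} pl pp M D = record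
  { N⊥K      = coprime-*ˡ N⊥K (coprime-∣ʳ B⊥K (n∣m*n N))
  ; l∤N      = [ l∤N , l∤B ] ∘ euclidsLemma N B pl
  ; s∣period = λ NB∣d → p*t∣period (∣-trans (n∣m*n N) NB∣d)
                                   (s∣period (∣-trans (m∣m*n B) NB∣d)) }
  where
  open Modulus M
  open CyclotomicDivisor D using (B)
  open CyclotomicDivisorProperties pl pp D

modulus-product : ∀ {l K} → Prime l → Coprime K l → ∀ {ps} → All Prime ps →
                  ∃[ N ] Modulus l K (product ps) N
modulus-product pl K⊥l []         = 1 , modulus-1 pl
modulus-product pl K⊥l (pp ∷ pps) with modulus-product pl K⊥l pps
... | _ , M =
  _ , modulus-* pl pp M (cyclotomicDivisor pl pp (productOfPrimes≥1 pps) (modulus-coprime pl K⊥l M))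

modulus-noHalfPeriod : ∀ {l K s N₁} → Prime l → Coprime K l → 0 < s → 2 ∣ s → Modulus l K s N₁ →
  ∃[ N ] (Modulus l K s N × ∃[ r ] (IsMultOrder l N r × (2 ∣ r → ¬ N ∣ l ^ (r / 2) + 1)))
modulus-noHalfPeriod {l} {K} {s} {N₁} pl K⊥l s>0 2∣s M₁ =
  N₁ * B , modulus-∣ (n∣m*n 2) (modulus-* pl prime[2] M₁ D) ,
  with-half (order-exists (*-mono-< T>0 (s≤s z≤n)) N₁B∣2T)
  where
  open Modulus M₁
  instance
    _ = prime⇒nonZero pl
    N₁≢0 = ∤⇒nonZero l∤N
  D = cyclotomicDivisor pl prime[2] s>0 (modulus-coprime pl K⊥l M₁)
  open CyclotomicDivisor D using (T; T>0; K∣; B; 1<B; B∣geom; p∣B∸1)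
  open CyclotomicDivisorProperties pl prime[2] D using (B⊥K)
  instance _ = m*n≢0 N₁ B {{N₁≢0}} {{>-nonZero (<-trans z<s 1<B)}}
  N₁∣T : N₁ ∣ l ^ T ∸ 1
  N₁∣T = ∣-trans (m∣m*n K) K∣
  N₁B∣2T : N₁ * B ∣ l ^ (T * 2) ∸ 1
  N₁B∣2T = coprime⇒*∣ (coprime-sym (coprime-∣ʳ B⊥K (m∣m*n K))) (∣^∸1⇒∣^*∸1 T 2 N₁∣T)
    (subst (λ e → B ∣ e ∸ 1) (^-*-assoc l T 2) (∣geom⇒∣^∸1 2 (m^n>0 l T) B∣geom))
  with-half : ∃[ r ] IsMultOrder l (N₁ * B) r →
              ∃[ r ] (IsMultOrder l (N₁ * B) r × (2 ∣ r → ¬ N₁ * B ∣ l ^ (r / 2) + 1))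
  with-half (r , order@(_ , N∣r , _)) = r , order , half
    where
    N₁∤2 : ¬ N₁ ∣ 2
    N₁∤2 = evenPeriods⇒∤2 pl l∤N (∣-trans 2∣s ∘ s∣period)
    half : 2 ∣ r → ¬ N₁ * B ∣ l ^ (r / 2) + 1
    half (divides h refl) = subst (λ e → ¬ N₁ * B ∣ l ^ e + 1) (sym (m*n/n≡m h 2))
      (¬∣half-period+1 {l} {N₁} {B} {T} {h} N₁∤2 (odd>1⇒∤2 1<B p∣B∸1) N₁∣T
        (subst (B ∣_) (geom-2 (l ^ T)) B∣geom) N∣r (*-cancelʳ-∣ 2 (order∣period order N₁B∣2T)))

∤-primes : ∀ {l S N} → All Prime S → Coprime N (product (filter (¬? ∘ (_≟ l)) S)) → ¬ l ∣ N →
           ∀ q → q ∈ S → ¬ q ∣ N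
∤-primes {l} S-prime N⊥K l∤N q q∈S q∣N with q ≟ l
... | yes refl = l∤N q∣N
... | no  q≢l  = prime⇒≢1 (lookup S-prime q∈S)
                   (N⊥K (q∣N , ∈⇒∣product (∈-filter⁺ (¬? ∘ (_≟ l)) q∈S q≢l)))

lemma2p3 : (l : ℕ) → Prime l → (s : ℕ) → 0 < s → (S : List ℕ) → All Prime S →
    ∃[ N ] (0 < N × ¬ (l ∣ N) × (∀ p → p ∈ S → ¬ (p ∣ N)) ×
      ∃[ r ] (IsMultOrder l N r × s ∣ r × (2 ∣ r → ¬ (N ∣ (l ^ (r / 2) + 1)))))
lemma2p3 l pl s s>0 S S-prime =
  let N₁-modulus = proj₂ (modulus-product pl K⊥l (prime[2] ∷ factorsPrime))
      N , M , r , order@(_ , N∣r , _) , half = modulus-noHalfPeriod pl K⊥l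
        (productOfPrimes≥1 (prime[2] ∷ factorsPrime)) (m∣m*n (product factors)) N₁-modulus
      open Modulus M
  in  N , >-nonZero⁻¹ N {{∤⇒nonZero l∤N}} , l∤N , ∤-primes S-prime N⊥K l∤N ,
      r , order , subst (_∣ r) (sym isFactorisation) (∣-trans (n∣m*n 2) (s∣period N∣r)) , half
  where
  open PrimeFactorisation (factorise s {{>-nonZero s>0}})
  K⊥l : Coprime (product (filter (¬? ∘ (_≟ l)) S)) l
  K⊥l = product-coprime pl (filter⁺ _ S-prime) (all-filter _ S)
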